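{- The sentence $\beta:=\exists x\,\exists y\,(Ux\wedge\neg Exy)$ (over the signature $\{E,U\}$, $E$ binary, $U$ unary) does not have a Gaifman normal form with distance formulae over min-max semirings; that is, no positive Boolean combination of basic local sentences with distance formulae (as defined in the context) is minmax-equivalent to $\beta$.
   Context: A min-max semiring is $(K,\max,\min,0,1)$ for a total order with least element $0$ and greatest element $1$. A $K$-interpretation is a map $\pi$ from instantiated literals ($Ea b,\neg Eab,Ua,\neg Ua$ over a finite universe $A$) to $K$, model-defining (exactly one of each complementary pair is $0$) and tracking only positive information (negative literals get values in $\{0,1\}$). Formulae in negation normal form are evaluated by $a=a\mapsto1$, $a=b\mapsto0$ ($a\ne b$; dually for $\ne$), literals via $\pi$, $\vee,\exists\mapsto\max$, $\wedge,\forall\mapsto\min$ (quantifiers over all of $A$). Distance formulae are defined inductively as ordinary first-order formulae: $d(x,y)\le0:=x=y$, $d(x,y)\le r+1:=\exists z((Exz\vee Ezx)\wedge d(z,y)\le r)$, and dually $d(x,y)>0:=x\ne y$, $d(x,y)>r+1:=\forall z((\neg Exz\wedge\neg Ezx)\vee d(z,y)>r)$. An $r$-local formula $\varphi^{(r)}(x)$ (with distance formulae) is a formula in negation normal form in which every quantifier is relativised around $x$: each $\exists y\,\theta$ appears as $\exists y(d(x,y)\le r\wedge\theta)$ and each $\forall y\,\theta$ as $\forall y(d(x,y)>r\vee\theta)$. Basic local sentences (with distance formulae) are $\exists x_1\dots\exists x_m\big(\bigwedge_{i<j}d(x_i,x_j)>2r\wedge\bigwedge_i\varphi^{(r)}(x_i)\big)$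 and $\forall x_1\dots\forall x_m\big(\bigvee_{i<j}d(x_i,x_j)\le2r\vee\bigvee_i\varphi^{(r)}(x_i)\big)$. Minmax-equivalent: equal value under every $K$-interpretation for every min-max semiring $K$. -}

module Defs where

open import Level using (0ℓ)
open import Data.Nat using (ℕ; zero; suc; _*_)
open import Data.Fin using (Fin; zero; suc) renaming (_≟_ to _≟ᶠ_)
open import Data.List using (List; []; _∷_; _++_; map)
open import Data.Product using (_×_; _,_)
open import Data.Sum using (_⊎_)
open import Relation.Nullary using (¬_; yes; no)
open import Relation.Binary.Bundles using (DecTotalOrder)

-- Min-max semirings: a (decidable) total order with least element 0
-- and greatest element 1; addition = max, multiplication = min.

record MinMaxSemiring : Set₁ where
  field
    order    : DecTotalOrder 0ℓ 0ℓ 0ℓ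
  open DecTotalOrder order public
  field
    𝟘        : Carrier
    𝟙        : Carrier
    𝟘-least  : ∀ x → 𝟘 ≤ x
    𝟙-greatest : ∀ x → x ≤ 𝟙

  max : Carrier → Carrier → Carrier
  max x y with x ≤? y
  ... | yes _ = y
  ... | no  _ = x

  min : Carrier → Carrier → Carrier
  min x y with x ≤? y
  ... | yes _ = x
  ... | no  _ = y

-- First-order formulae in negation normal form over {E, U}
-- (E binary, U unary), scoped de Bruijn syntax: a formula of type
-- Fm n has its free variables among Fin n; ∃' / ∀' bind variable zero.

data Fm (n : ℕ) : Set where
  eq neq : Fin n → Fin n → Fm n
  E nE   : Fin n → Fin n → Fm n
  U nU   : Fin n → Fm n
  _∨'_ _∧'_ : Fm n → Fm n → Fm n
  ∃' ∀'  : Fm (suc n) → Fm n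

infixr 6 _∧'_
infixr 5 _∨'_

lift : ∀ {n k} → (Fin n → Fin k) → Fin (suc n) → Fin (suc k)
lift ρ zero    = zero
lift ρ (suc i) = suc (ρ i)

rename : ∀ {n k} → (Fin n → Fin k) → Fm n → Fm k
rename ρ (eq x y)  = eq (ρ x) (ρ y)
rename ρ (neq x y) = neq (ρ x) (ρ y)
rename ρ (E x y)   = E (ρ x) (ρ y)
rename ρ (nE x y)  = nE (ρ x) (ρ y)
rename ρ (U x)     = U (ρ x)
rename ρ (nU x)    = nU (ρ x)
rename ρ (φ ∨' ψ)  = rename ρ φ ∨' rename ρ ψ
rename ρ (φ ∧' ψ)  = rename ρ φ ∧' rename ρ ψ
rename ρ (∃' φ)    = ∃' (rename (lift ρ) φ)
rename ρ (∀' φ)    = ∀' (rename (lift ρ) φ)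

data Lit (A : Set) : Set where
  posE negE : A → A → Lit A
  posU negU : A → Lit A

module _ (K : MinMaxSemiring) where
  open MinMaxSemiring K

  Interp : Set → Set
  Interp A = Lit A → Carrier

  ExactlyOneZero : Carrier → Carrier → Set
  ExactlyOneZero x y = (x ≈ 𝟘 × ¬ (y ≈ 𝟘)) ⊎ (¬ (x ≈ 𝟘) × y ≈ 𝟘)

  ModelDefining : ∀ {A} → Interp A → Set
  ModelDefining {A} π =
    (∀ (a b : A) → ExactlyOneZero (π (posE a b)) (π (negE a b))) ×
    (∀ (a : A) → ExactlyOneZero (π (posU a)) (π (negU a)))

  ZeroOrOne : Carrier → Set
  ZeroOrOne x = x ≈ 𝟘 ⊎ x ≈ 𝟙

  TracksPositive : ∀ {A} → Interp A → Set
  TracksPositive {A} π =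
    (∀ (a b : A) → ZeroOrOne (π (negE a b))) ×
    (∀ (a : A) → ZeroOrOne (π (negU a)))

  bigMax : ∀ {N} → (Fin N → Carrier) → Carrier
  bigMax {zero}  f = 𝟘
  bigMax {suc N} f = max (f zero) (bigMax (λ i → f (suc i)))

  bigMin : ∀ {N} → (Fin N → Carrier) → Carrier
  bigMin {zero}  f = 𝟙
  bigMin {suc N} f = min (f zero) (bigMin (λ i → f (suc i)))

  extend : ∀ {n} {A : Set} → (Fin n → A) → A → Fin (suc n) → A
  extend ν a zero    = a
  extend ν a (suc i) = ν i

  ⟦_⟧ : ∀ {N n} → Fm n → Interp (Fin N) → (Fin n → Fin N) → Carrier
  ⟦ eq x y ⟧  π ν with ν x ≟ᶠ ν y
  ... | yes _ = 𝟙
  ... | no  _ = 𝟘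
  ⟦ neq x y ⟧ π ν with ν x ≟ᶠ ν y
  ... | yes _ = 𝟘
  ... | no  _ = 𝟙
  ⟦ E x y ⟧   π ν = π (posE (ν x) (ν y))
  ⟦ nE x y ⟧  π ν = π (negE (ν x) (ν y))
  ⟦ U x ⟧     π ν = π (posU (ν x))
  ⟦ nU x ⟧    π ν = π (negU (ν x))
  ⟦ φ ∨' ψ ⟧  π ν = max (⟦ φ ⟧ π ν) (⟦ ψ ⟧ π ν)
  ⟦ φ ∧' ψ ⟧  π ν = min (⟦ φ ⟧ π ν) (⟦ ψ ⟧ π ν)
  ⟦ ∃' φ ⟧    π ν = bigMax (λ a → ⟦ φ ⟧ π (extend ν a))
  ⟦ ∀' φ ⟧    π ν = bigMin (λ a → ⟦ φ ⟧ π (extend ν a))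

noVars : {A : Set} → Fin 0 → A
noVars ()

MinmaxEquivalent : Fm 0 → Fm 0 → Set₁
MinmaxEquivalent φ ψ =
  ∀ (K : MinMaxSemiring) (N : ℕ) (π : Interp K (Fin (suc N))) →
  ModelDefining K π → TracksPositive K π →
  MinMaxSemiring._≈_ K (⟦_⟧ K φ π noVars) (⟦_⟧ K ψ π noVars)

-- Distance formulae (ordinary first-order formulae)
--   d(x,y) ≤ 0   := x = y
--   d(x,y) ≤ r+1 := ∃z((Exz ∨ Ezx) ∧ d(z,y) ≤ r)
--   d(x,y) > 0   := x ≠ y
--   d(x,y) > r+1 := ∀z((¬Exz ∧ ¬Ezx) ∨ d(z,y) > r)

dist≤ : ∀ {n} → ℕ → Fin n → Fin n → Fm n
dist≤ zero    x y = eq x y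
dist≤ (suc r) x y = ∃' ((E (suc x) zero ∨' E zero (suc x)) ∧' dist≤ r zero (suc y))

dist> : ∀ {n} → ℕ → Fin n → Fin n → Fm n
dist> zero    x y = neq x y
dist> (suc r) x y = ∀' ((nE (suc x) zero ∧' nE zero (suc x)) ∨' dist> r zero (suc y))

data IsLocal (r : ℕ) : ∀ {n} → Fin n → Fm n → Set where
  l-eq  : ∀ {n} {c : Fin n} x y → IsLocal r c (eq x y)
  l-neq : ∀ {n} {c : Fin n} x y → IsLocal r c (neq x y)
  l-E   : ∀ {n} {c : Fin n} x y → IsLocal r c (E x y)
  l-nE  : ∀ {n} {c : Fin n} x y → IsLocal r c (nE x y)
  l-U   : ∀ {n} {c : Fin n} x → IsLocal r c (U x)
  l-nU  : ∀ {n} {c : Fin n} x → IsLocal r c (nU x)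
  l-∨   : ∀ {n} {c : Fin n} {φ ψ} → IsLocal r c φ → IsLocal r c ψ → IsLocal r c (φ ∨' ψ)
  l-∧   : ∀ {n} {c : Fin n} {φ ψ} → IsLocal r c φ → IsLocal r c ψ → IsLocal r c (φ ∧' ψ)
  l-∃   : ∀ {n} {c : Fin n} {θ} → IsLocal r (suc c) θ →
          IsLocal r c (∃' (dist≤ r (suc c) zero ∧' θ))
  l-∀   : ∀ {n} {c : Fin n} {θ} → IsLocal r (suc c) θ →
          IsLocal r c (∀' (dist> r (suc c) zero ∨' θ))

⋀ : ∀ {n} → Fm n → List (Fm n) → Fm n
⋀ φ []       = φ
⋀ φ (ψ ∷ ψs) = φ ∧' ⋀ ψ ψs

⋁ : ∀ {n} → Fm n → List (Fm n) → Fm n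
⋁ φ []       = φ
⋁ φ (ψ ∷ ψs) = φ ∨' ⋁ ψ ψs

allFin : ∀ m → List (Fin m)
allFin zero    = []
allFin (suc m) = zero ∷ map suc (allFin m)

pairs : ∀ m → List (Fin m × Fin m)
pairs zero    = []
pairs (suc m) = map (λ j → (zero , suc j)) (allFin m)
             ++ map (λ { (i , j) → (suc i , suc j) }) (pairs m)

exists* : ∀ m → Fm m → Fm 0
exists* zero    φ = φ
exists* (suc m) φ = exists* m (∃' φ)

forall* : ∀ m → Fm m → Fm 0
forall* zero    φ = φ
forall* (suc m) φ = forall* m (∀' φ)

at : ∀ {m} → Fm 1 → Fin m → Fm m
at φ i = rename (λ _ → i) φ

-- ∃x₁…∃x_m (⋀_{i<j} d(x_i,x_j) > 2r ∧ ⋀_i φ(x_i)),   m = suc k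
basicLocal∃ : ℕ → (k : ℕ) → Fm 1 → Fm 0
basicLocal∃ r k φ =
  exists* (suc k)
    (⋀ (at φ zero)
       (map (λ { (i , j) → dist> (2 * r) i j }) (pairs (suc k))
        ++ map (λ i → at φ (suc i)) (allFin k)))

-- ∀x₁…∀x_m (⋁_{i<j} d(x_i,x_j) ≤ 2r ∨ ⋁_i φ(x_i)),   m = suc k
basicLocal∀ : ℕ → (k : ℕ) → Fm 1 → Fm 0
basicLocal∀ r k φ =
  forall* (suc k)
    (⋁ (at φ zero)
       (map (λ { (i , j) → dist≤ (2 * r) i j }) (pairs (suc k))
        ++ map (λ i → at φ (suc i)) (allFin k)))

data IsBasicLocal : Fm 0 → Set where
  bl-∃ : ∀ r k (φ : Fm 1) → IsLocal r zero φ → IsBasicLocal (basicLocal∃ r k φ)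
  bl-∀ : ∀ r k (φ : Fm 1) → IsLocal r zero φ → IsBasicLocal (basicLocal∀ r k φ)

data IsPosBoolCombBL : Fm 0 → Set where
  pb-base : ∀ {φ} → IsBasicLocal φ → IsPosBoolCombBL φ
  pb-∨    : ∀ {φ ψ} → IsPosBoolCombBL φ → IsPosBoolCombBL ψ → IsPosBoolCombBL (φ ∨' ψ)
  pb-∧    : ∀ {φ ψ} → IsPosBoolCombBL φ → IsPosBoolCombBL ψ → IsPosBoolCombBL (φ ∧' ψ)

-- β := ∃x ∃y (Ux ∧ ¬Exy)   (x = suc zero, y = zero)
β : Fm 0
β = ∃' (∃' (U (suc zero) ∧' nE (suc zero) zero))

-- Work in the three-element chain 𝟘 < ε < 𝟙 over a universe of M + 2 elements, with U true
-- everywhere, E u u = 𝟙 and E u v = ε for u ≠ v. In πA the single literal ¬E e₀ e₁ is 𝟙 (and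
-- E e₀ e₁ is 𝟘), so β = 𝟙; in πB every literal ¬E u v is 𝟘, so β = 𝟘. Read at value 𝟙, distance
-- collapses to equality in both interpretations, and ¬E is never 𝟙 on an assignment that avoids
-- the pair (e₀, e₁). A back-and-forth induction on local formulas therefore transfers value 𝟙
-- from πA to πB between assignments with the same equality type, the A-side avoiding (e₀, e₁);
-- choosing M above the quantifier rank leaves fresh elements for the universal steps. So every
-- positive Boolean combination of basic local sentences with value 𝟙 under πA has value 𝟙
-- under πB, which β has not.

module Submission where

open import Defs
open import Data.Product using (Σ; _×_)
open import Relation.Nullary using (¬_)

open import Data.Nat using (ℕ; zero; suc; _+_; _*_; _⊔_; _≤_; _<_; z≤n; s≤s)
open import Data.Nat.Properties using (≤-trans; ≤-refl; +-monoˡ-≤; m≤m⊔n; m≤n⊔m; +-suc; m≤n+m; <⇒≱)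
open import Data.Fin using (Fin; zero; suc; _≟_)
open import Data.Fin.Properties using (≤-decTotalOrder; ≤fromℕ; ≤-antisym; any?; ¬∀⟶∃¬; injective⇒≤)
open import Data.Product using (_,_; proj₁; proj₂; ∃; uncurry)
import Data.Product as Product
open import Data.Sum using (_⊎_; inj₁; inj₂; [_,_]′)
import Data.Sum as Sum
open import Data.Empty using (⊥; ⊥-elim)
open import Data.List using ([]; _∷_; map)
open import Data.List.Relation.Unary.All using (All; []; _∷_; universal)
open import Data.List.Relation.Unary.All.Properties using (map⁺; ++⁺)
open import Function using (_∘_; id)
open import Function.Bundles using (_⇔_; mk⇔; Equivalence)
import Function.Properties.Equivalence as ⇔
open import Relation.Nullary using (Dec; yes; no; contradiction)
open import Relation.Nullary.Decidable using (_×-dec_)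
open import Relation.Binary.PropositionalEquality using (_≡_; _≢_; refl; sym; trans; cong; cong₂; subst; module ≡-Reasoning)
open Equivalence using (to; from)

<⇒notOnto : ∀ {n m} → n < m → (f : Fin n → Fin m) → ¬ (∀ y → ∃ λ i → f i ≡ y)
<⇒notOnto n<m f onto = <⇒≱ n<m (injective⇒≤ section-injective)
  where
  section-injective : ∀ {y z} → proj₁ (onto y) ≡ proj₁ (onto z) → y ≡ z
  section-injective {y} {z} same = trans (sym (proj₂ (onto y))) (trans (cong f same) (proj₂ (onto z)))

missingValue : ∀ {n m} → n < m → (f : Fin n → Fin m) → ∃ λ y → ∀ i → f i ≢ y
missingValue {m = m} n<m f
  with ¬∀⟶∃¬ m (λ y → ∃ λ i → f i ≡ y) (λ y → any? (λ i → f i ≟ y)) (<⇒notOnto n<m f)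
... | y , missed = y , λ i fi≡y → missed (i , fi≡y)

⊔+≤⇒ˡ : ∀ a b {n k} → (a ⊔ b) + n ≤ k → a + n ≤ k
⊔+≤⇒ˡ a b {n} = ≤-trans (+-monoˡ-≤ n (m≤m⊔n a b))

⊔+≤⇒ʳ : ∀ a b {n k} → (a ⊔ b) + n ≤ k → b + n ≤ k
⊔+≤⇒ʳ a b {n} = ≤-trans (+-monoˡ-≤ n (m≤n⊔m a b))

suc+≤⇒+suc : ∀ a {n k} → suc a + n ≤ k → a + suc n ≤ k
suc+≤⇒+suc a {n} {k} = subst (_≤ k) (sym (+-suc a n))

suc+≤⇒suc≤ : ∀ a {n k} → suc a + n ≤ k → suc n ≤ k
suc+≤⇒suc≤ a {n} = ≤-trans (s≤s (m≤n+m n a))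

module _ (K : MinMaxSemiring) where
  open MinMaxSemiring K using (Carrier; max; min)

  bigMax-cong : ∀ {N} {f g : Fin N → Carrier} → (∀ i → f i ≡ g i) → bigMax K f ≡ bigMax K g
  bigMax-cong {zero}  _   = refl
  bigMax-cong {suc N} f≗g = cong₂ max (f≗g zero) (bigMax-cong (f≗g ∘ suc))

  bigMin-cong : ∀ {N} {f g : Fin N → Carrier} → (∀ i → f i ≡ g i) → bigMin K f ≡ bigMin K g
  bigMin-cong {zero}  _   = refl
  bigMin-cong {suc N} f≗g = cong₂ min (f≗g zero) (bigMin-cong (f≗g ∘ suc))

  extend-lift : ∀ {n k} {A : Set} {ρ : Fin n → Fin k} {ν : Fin k → A} {μ : Fin n → A} →
                (∀ i → ν (ρ i) ≡ μ i) → ∀ a i → extend K ν a (lift ρ i) ≡ extend K μ a i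
  extend-lift h a zero    = refl
  extend-lift h a (suc i) = h i

  ⟦eq⟧-cong : ∀ {N n k} (π : Interp K (Fin N)) (ν : Fin k → Fin N) (μ : Fin n → Fin N) x′ y′ x y →
              ν x′ ≡ μ x → ν y′ ≡ μ y → ⟦_⟧ K (eq x′ y′) π ν ≡ ⟦_⟧ K (eq x y) π μ
  ⟦eq⟧-cong π ν μ x′ y′ x y hx hy with ν x′ ≟ ν y′ | μ x ≟ μ y
  ... | yes _ | yes _ = refl
  ... | no  _ | no  _ = refl
  ... | yes p | no ¬q = contradiction (trans (sym hx) (trans p hy)) ¬q
  ... | no ¬p | yes q = contradiction (trans hx (trans q (sym hy))) ¬p

  ⟦neq⟧-cong : ∀ {N n k} (π : Interp K (Fin N)) (ν : Fin k → Fin N) (μ : Fin n → Fin N) x′ y′ x y →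
               ν x′ ≡ μ x → ν y′ ≡ μ y → ⟦_⟧ K (neq x′ y′) π ν ≡ ⟦_⟧ K (neq x y) π μ
  ⟦neq⟧-cong π ν μ x′ y′ x y hx hy with ν x′ ≟ ν y′ | μ x ≟ μ y
  ... | yes _ | yes _ = refl
  ... | no  _ | no  _ = refl
  ... | yes p | no ¬q = contradiction (trans (sym hx) (trans p hy)) ¬q
  ... | no ¬p | yes q = contradiction (trans hx (trans q (sym hy))) ¬p

  ⟦rename⟧ : ∀ {N n k} (π : Interp K (Fin N)) (ρ : Fin n → Fin k) (φ : Fm n)
             {ν : Fin k → Fin N} {μ : Fin n → Fin N} →
             (∀ i → ν (ρ i) ≡ μ i) → ⟦_⟧ K (rename ρ φ) π ν ≡ ⟦_⟧ K φ π μ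
  ⟦rename⟧ π ρ (eq x y)  {ν} {μ} h = ⟦eq⟧-cong π ν μ (ρ x) (ρ y) x y (h x) (h y)
  ⟦rename⟧ π ρ (neq x y) {ν} {μ} h = ⟦neq⟧-cong π ν μ (ρ x) (ρ y) x y (h x) (h y)
  ⟦rename⟧ π ρ (E x y)   h rewrite h x | h y = refl
  ⟦rename⟧ π ρ (nE x y)  h rewrite h x | h y = refl
  ⟦rename⟧ π ρ (U x)     h rewrite h x = refl
  ⟦rename⟧ π ρ (nU x)    h rewrite h x = refl
  ⟦rename⟧ π ρ (φ ∨' ψ)  h = cong₂ max (⟦rename⟧ π ρ φ h) (⟦rename⟧ π ρ ψ h)
  ⟦rename⟧ π ρ (φ ∧' ψ)  h = cong₂ min (⟦rename⟧ π ρ φ h) (⟦rename⟧ π ρ ψ h)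
  ⟦rename⟧ π ρ (∃' φ)    h = bigMax-cong λ a → ⟦rename⟧ π (lift ρ) φ (extend-lift h a)
  ⟦rename⟧ π ρ (∀' φ)    h = bigMin-cong λ a → ⟦rename⟧ π (lift ρ) φ (extend-lift h a)

K₃ : MinMaxSemiring
K₃ = record
  { order      = ≤-decTotalOrder 3
  ; 𝟘          = zero
  ; 𝟙          = suc (suc zero)
  ; 𝟘-least    = λ _ → z≤n
  ; 𝟙-greatest = ≤fromℕ
  }

open MinMaxSemiring K₃ using (𝟘; 𝟙; max; min; _≤?_) renaming (_≤_ to _≤₃_)

Val : Set
Val = Fin 3

ε : Val
ε = suc zero

𝟘≢𝟙 : 𝟘 ≢ 𝟙
𝟘≢𝟙 ()

ε≢𝟙 : ε ≢ 𝟙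
ε≢𝟙 ()

𝟙≤⇒≡𝟙 : ∀ {x} → 𝟙 ≤₃ x → x ≡ 𝟙
𝟙≤⇒≡𝟙 {x} 𝟙≤x = ≤-antisym (≤fromℕ x) 𝟙≤x

max≡𝟙⁻ : ∀ x y → max x y ≡ 𝟙 → x ≡ 𝟙 ⊎ y ≡ 𝟙
max≡𝟙⁻ x y e with x ≤? y
... | yes _ = inj₂ e
... | no  _ = inj₁ e

max≡𝟙⁺ : ∀ x y → x ≡ 𝟙 ⊎ y ≡ 𝟙 → max x y ≡ 𝟙
max≡𝟙⁺ _ y (inj₁ refl) with 𝟙 ≤? y
... | yes 𝟙≤y = 𝟙≤⇒≡𝟙 𝟙≤y
... | no  _   = refl
max≡𝟙⁺ x _ (inj₂ refl) with x ≤? 𝟙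
... | yes _   = refl
... | no  x≰𝟙 = contradiction (≤fromℕ x) x≰𝟙

min≡𝟙⁻ : ∀ x y → min x y ≡ 𝟙 → x ≡ 𝟙 × y ≡ 𝟙
min≡𝟙⁻ x y e with x ≤? y
... | yes x≤y = e , 𝟙≤⇒≡𝟙 (subst (_≤₃ y) e x≤y)
... | no  x≰y = contradiction (subst (x ≤₃_) (sym e) (≤fromℕ x)) x≰y , e

min≡𝟙⁺ : ∀ {x y} → x ≡ 𝟙 → y ≡ 𝟙 → min x y ≡ 𝟙
min≡𝟙⁺ refl refl = refl

bigMax≡𝟙⁻ : ∀ {N} (f : Fin N → Val) → bigMax K₃ f ≡ 𝟙 → ∃ λ i → f i ≡ 𝟙
bigMax≡𝟙⁻ {zero}  f ()
bigMax≡𝟙⁻ {suc N} f e with max≡𝟙⁻ (f zero) (bigMax K₃ (f ∘ suc)) e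
... | inj₁ f₀≡𝟙   = zero , f₀≡𝟙
... | inj₂ rest≡𝟙 = Product.map suc id (bigMax≡𝟙⁻ (f ∘ suc) rest≡𝟙)

bigMax≡𝟙⁺ : ∀ {N} (f : Fin N → Val) i → f i ≡ 𝟙 → bigMax K₃ f ≡ 𝟙
bigMax≡𝟙⁺ {suc N} f zero    e = max≡𝟙⁺ (f zero) (bigMax K₃ (f ∘ suc)) (inj₁ e)
bigMax≡𝟙⁺ {suc N} f (suc i) e = max≡𝟙⁺ (f zero) (bigMax K₃ (f ∘ suc)) (inj₂ (bigMax≡𝟙⁺ (f ∘ suc) i e))

bigMax≡𝟘 : ∀ {N} (f : Fin N → Val) → (∀ i → f i ≡ 𝟘) → bigMax K₃ f ≡ 𝟘
bigMax≡𝟘 {zero}  f _   = refl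
bigMax≡𝟘 {suc N} f f≗𝟘 = cong₂ max (f≗𝟘 zero) (bigMax≡𝟘 (f ∘ suc) (f≗𝟘 ∘ suc))

bigMin≡𝟙⁻ : ∀ {N} (f : Fin N → Val) → bigMin K₃ f ≡ 𝟙 → ∀ i → f i ≡ 𝟙
bigMin≡𝟙⁻ {suc N} f e zero    = proj₁ (min≡𝟙⁻ (f zero) (bigMin K₃ (f ∘ suc)) e)
bigMin≡𝟙⁻ {suc N} f e (suc i) = bigMin≡𝟙⁻ (f ∘ suc) (proj₂ (min≡𝟙⁻ (f zero) (bigMin K₃ (f ∘ suc)) e)) i

bigMin≡𝟙⁺ : ∀ {N} (f : Fin N → Val) → (∀ i → f i ≡ 𝟙) → bigMin K₃ f ≡ 𝟙
bigMin≡𝟙⁺ {zero}  f _   = refl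
bigMin≡𝟙⁺ {suc N} f f≗𝟙 = min≡𝟙⁺ (f≗𝟙 zero) (bigMin≡𝟙⁺ (f ∘ suc) (f≗𝟙 ∘ suc))

-- A record rather than a synonym, so that φ and ν can be inferred from a proof.
infix 4 _⊨_[_]
record _⊨_[_] {N n} (π : Interp K₃ (Fin N)) (φ : Fm n) (ν : Fin n → Fin N) : Set where
  constructor ⊨-by
  field value≡𝟙 : ⟦_⟧ K₃ φ π ν ≡ 𝟙
open _⊨_[_]

infixl 5 _▹_
_▹_ : ∀ {n} {A : Set} → (Fin n → A) → A → Fin (suc n) → A
ν ▹ a = extend K₃ ν a

module _ {N n} {π : Interp K₃ (Fin N)} {ν : Fin n → Fin N} where

  ⊨eq⁻ : ∀ {x y} → π ⊨ eq x y [ ν ] → ν x ≡ ν y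
  ⊨eq⁻ {x} {y} (⊨-by e) with ν x ≟ ν y
  ... | yes νx≡νy = νx≡νy
  ... | no  _     = contradiction e 𝟘≢𝟙

  ⊨eq⁺ : ∀ {x y} → ν x ≡ ν y → π ⊨ eq x y [ ν ]
  ⊨eq⁺ {x} {y} νx≡νy = ⊨-by value
    where
    value : ⟦_⟧ K₃ (eq x y) π ν ≡ 𝟙
    value with ν x ≟ ν y
    ... | yes _     = refl
    ... | no  νx≢νy = contradiction νx≡νy νx≢νy

  ⊨neq⁻ : ∀ {x y} → π ⊨ neq x y [ ν ] → ν x ≢ ν y
  ⊨neq⁻ {x} {y} (⊨-by e) with ν x ≟ ν y
  ... | yes _     = contradiction e 𝟘≢𝟙
  ... | no  νx≢νy = νx≢νy

  ⊨neq⁺ : ∀ {x y} → ν x ≢ ν y → π ⊨ neq x y [ ν ]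
  ⊨neq⁺ {x} {y} νx≢νy = ⊨-by value
    where
    value : ⟦_⟧ K₃ (neq x y) π ν ≡ 𝟙
    value with ν x ≟ ν y
    ... | yes νx≡νy = contradiction νx≡νy νx≢νy
    ... | no  _     = refl

  ⊨∨⁻ : ∀ {φ ψ} → π ⊨ φ ∨' ψ [ ν ] → π ⊨ φ [ ν ] ⊎ π ⊨ ψ [ ν ]
  ⊨∨⁻ {φ} {ψ} (⊨-by e) = Sum.map ⊨-by ⊨-by (max≡𝟙⁻ (⟦_⟧ K₃ φ π ν) (⟦_⟧ K₃ ψ π ν) e)

  ⊨∨⁺ : ∀ {φ ψ} → π ⊨ φ [ ν ] ⊎ π ⊨ ψ [ ν ] → π ⊨ φ ∨' ψ [ ν ]
  ⊨∨⁺ {φ} {ψ} h = ⊨-by (max≡𝟙⁺ (⟦_⟧ K₃ φ π ν) (⟦_⟧ K₃ ψ π ν) (Sum.map value≡𝟙 value≡𝟙 h))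

  ⊨∧⁻ : ∀ {φ ψ} → π ⊨ φ ∧' ψ [ ν ] → π ⊨ φ [ ν ] × π ⊨ ψ [ ν ]
  ⊨∧⁻ {φ} {ψ} (⊨-by e) = Product.map ⊨-by ⊨-by (min≡𝟙⁻ (⟦_⟧ K₃ φ π ν) (⟦_⟧ K₃ ψ π ν) e)

  ⊨∧⁺ : ∀ {φ ψ} → π ⊨ φ [ ν ] → π ⊨ ψ [ ν ] → π ⊨ φ ∧' ψ [ ν ]
  ⊨∧⁺ (⊨-by eφ) (⊨-by eψ) = ⊨-by (min≡𝟙⁺ eφ eψ)

  ⊨∃⁻ : ∀ {φ} → π ⊨ ∃' φ [ ν ] → ∃ λ a → π ⊨ φ [ ν ▹ a ]
  ⊨∃⁻ {φ} (⊨-by e) = Product.map₂ ⊨-by (bigMax≡𝟙⁻ (λ a → ⟦_⟧ K₃ φ π (ν ▹ a)) e)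

  ⊨∃⁺ : ∀ {φ} a → π ⊨ φ [ ν ▹ a ] → π ⊨ ∃' φ [ ν ]
  ⊨∃⁺ {φ} a (⊨-by e) = ⊨-by (bigMax≡𝟙⁺ (λ a → ⟦_⟧ K₃ φ π (ν ▹ a)) a e)

  ⊨∀⁻ : ∀ {φ} → π ⊨ ∀' φ [ ν ] → ∀ a → π ⊨ φ [ ν ▹ a ]
  ⊨∀⁻ {φ} (⊨-by e) a = ⊨-by (bigMin≡𝟙⁻ (λ a → ⟦_⟧ K₃ φ π (ν ▹ a)) e a)

  ⊨∀⁺ : ∀ {φ} → (∀ a → π ⊨ φ [ ν ▹ a ]) → π ⊨ ∀' φ [ ν ]
  ⊨∀⁺ {φ} h = ⊨-by (bigMin≡𝟙⁺ (λ a → ⟦_⟧ K₃ φ π (ν ▹ a)) (value≡𝟙 ∘ h))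

module _ {N} {π : Interp K₃ (Fin N)} where

  dist≤-sound : (∀ {u v} → π (posE u v) ≡ 𝟙 → u ≡ v) →
                ∀ s {m} (x y : Fin m) {ν} → π ⊨ dist≤ s x y [ ν ] → ν x ≡ ν y
  dist≤-sound E⇒≡ zero    x y e = ⊨eq⁻ e
  dist≤-sound E⇒≡ (suc s) x y e =
    let z , e′ = ⊨∃⁻ e
        adjacent , rest = ⊨∧⁻ e′
    in trans ([ E⇒≡ ∘ value≡𝟙 , sym ∘ E⇒≡ ∘ value≡𝟙 ]′ (⊨∨⁻ adjacent)) (dist≤-sound E⇒≡ s zero (suc y) rest)

  dist≤-complete : (∀ u → π (posE u u) ≡ 𝟙) →
                   ∀ s {m} (x y : Fin m) {ν} → ν x ≡ ν y → π ⊨ dist≤ s x y [ ν ]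
  dist≤-complete loop zero    x y νx≡νy = ⊨eq⁺ νx≡νy
  dist≤-complete loop (suc s) x y {ν} νx≡νy =
    ⊨∃⁺ (ν x) (⊨∧⁺ (⊨∨⁺ (inj₁ (⊨-by (loop (ν x))))) (dist≤-complete loop s zero (suc y) νx≡νy))

  ¬⊨dist>-suc : (∀ {u v} → π (negE u v) ≡ 𝟙 → π (negE v u) ≡ 𝟙 → ⊥) →
                ∀ s {m} (x y : Fin m) {ν} → ¬ (π ⊨ dist> (suc s) x y [ ν ])
  ¬⊨dist>-suc ¬E-asym s x y {ν} e with ⊨∨⁻ (⊨∀⁻ e (ν y))
  ... | inj₁ nonadjacent = uncurry ¬E-asym (Product.map value≡𝟙 value≡𝟙 (⊨∧⁻ nonadjacent))
  ... | inj₂ far with s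
  ...   | zero   = ⊨neq⁻ far refl
  ...   | suc s′ = ¬⊨dist>-suc ¬E-asym s′ zero (suc y) far

rank : ∀ {r n} {c : Fin n} {φ} → IsLocal r c φ → ℕ
rank (l-eq _ _)  = 0
rank (l-neq _ _) = 0
rank (l-E _ _)   = 0
rank (l-nE _ _)  = 0
rank (l-U _)     = 0
rank (l-nU _)    = 0
rank (l-∨ p q)   = rank p ⊔ rank q
rank (l-∧ p q)   = rank p ⊔ rank q
rank (l-∃ p)     = suc (rank p)
rank (l-∀ p)     = suc (rank p)

pbRank : ∀ {ψ} → IsPosBoolCombBL ψ → ℕ
pbRank (pb-base (bl-∃ _ _ _ p)) = rank p
pbRank (pb-base (bl-∀ _ _ _ p)) = rank p
pbRank (pb-∨ d e)               = pbRank d ⊔ pbRank e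
pbRank (pb-∧ d e)               = pbRank d ⊔ pbRank e

module Models (M : ℕ) where

  Uv : Set
  Uv = Fin (suc (suc M))

  e₀ e₁ : Uv
  e₀ = zero
  e₁ = suc zero

  e₀≢e₁ : e₀ ≢ e₁
  e₀≢e₁ ()

  NegEdge : Uv → Uv → Set
  NegEdge u v = u ≡ e₀ × v ≡ e₁

  negEdge? : ∀ u v → Dec (NegEdge u v)
  negEdge? u v = (u ≟ e₀) ×-dec (v ≟ e₁)

  NegEdge-irrefl : ∀ {u} → ¬ NegEdge u u
  NegEdge-irrefl (u≡e₀ , u≡e₁) = e₀≢e₁ (trans (sym u≡e₀) u≡e₁)

  πB : Interp K₃ Uv
  πB (posE u v) with u ≟ v
  ... | yes _ = 𝟙
  ... | no  _ = ε
  πB (negE _ _) = 𝟘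
  πB (posU _)   = 𝟙
  πB (negU _)   = 𝟘

  πA : Interp K₃ Uv
  πA (posE u v) with negEdge? u v
  ... | yes _ = 𝟘
  ... | no  _ = πB (posE u v)
  πA (negE u v) with negEdge? u v
  ... | yes _ = 𝟙
  ... | no  _ = 𝟘
  πA (posU _) = 𝟙
  πA (negU _) = 𝟘

  πB-E⇒≡ : ∀ {u v} → πB (posE u v) ≡ 𝟙 → u ≡ v
  πB-E⇒≡ {u} {v} e with u ≟ v
  ... | yes u≡v = u≡v
  ... | no  _   = contradiction e ε≢𝟙

  πB-E≢𝟘 : ∀ u v → πB (posE u v) ≢ 𝟘
  πB-E≢𝟘 u v with u ≟ v
  ... | yes _ = λ ()
  ... | no  _ = λ ()

  πB-loop : ∀ u → πB (posE u u) ≡ 𝟙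
  πB-loop u with u ≟ u
  ... | yes _   = refl
  ... | no  u≢u = contradiction refl u≢u

  πA-E⇒≡ : ∀ {u v} → πA (posE u v) ≡ 𝟙 → u ≡ v
  πA-E⇒≡ {u} {v} e with negEdge? u v
  ... | yes _ = contradiction e 𝟘≢𝟙
  ... | no  _ = πB-E⇒≡ e

  πA-¬E⇒NegEdge : ∀ {u v} → πA (negE u v) ≡ 𝟙 → NegEdge u v
  πA-¬E⇒NegEdge {u} {v} e with negEdge? u v
  ... | yes uv = uv
  ... | no  _  = contradiction e 𝟘≢𝟙

  πA-¬E-asym : ∀ {u v} → πA (negE u v) ≡ 𝟙 → πA (negE v u) ≡ 𝟙 → ⊥
  πA-¬E-asym uv vu with πA-¬E⇒NegEdge uv | πA-¬E⇒NegEdge vu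
  ... | refl , refl | v≡e₀ , _ = e₀≢e₁ (sym v≡e₀)

  πA-modelDefining : ModelDefining K₃ πA
  πA-modelDefining = edge , λ _ → inj₂ ((λ ()) , refl)
    where
    edge : ∀ u v → ExactlyOneZero K₃ (πA (posE u v)) (πA (negE u v))
    edge u v with negEdge? u v
    ... | yes _ = inj₁ (refl , λ ())
    ... | no  _ = inj₂ (πB-E≢𝟘 u v , refl)

  πB-modelDefining : ModelDefining K₃ πB
  πB-modelDefining = (λ u v → inj₂ (πB-E≢𝟘 u v , refl)) , λ _ → inj₂ ((λ ()) , refl)

  πA-tracksPositive : TracksPositive K₃ πA
  πA-tracksPositive = negEdge , λ _ → inj₁ refl
    where
    negEdge : ∀ u v → ZeroOrOne K₃ (πA (negE u v))
    negEdge u v with negEdge? u v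
    ... | yes _ = inj₂ refl
    ... | no  _ = inj₁ refl

  πB-tracksPositive : TracksPositive K₃ πB
  πB-tracksPositive = (λ _ _ → inj₁ refl) , λ _ → inj₁ refl

  πA⊨β : πA ⊨ β [ noVars ]
  πA⊨β = ⊨∃⁺ e₀ (⊨∃⁺ e₁ (⊨-by refl))

  πB-β≡𝟘 : ⟦_⟧ K₃ β πB noVars ≡ 𝟘
  πB-β≡𝟘 = bigMax≡𝟘 _ λ x →
             bigMax≡𝟘 (λ y → ⟦_⟧ K₃ (U (suc zero) ∧' nE (suc zero) zero) πB (noVars ▹ x ▹ y)) λ _ → refl

  SameEqType : ∀ {n} → (Fin n → Uv) → (Fin n → Uv) → Set
  SameEqType ν ν′ = ∀ i j → (ν i ≡ ν j) ⇔ (ν′ i ≡ ν′ j)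

  AvoidsNegEdge : ∀ {n} → (Fin n → Uv) → Set
  AvoidsNegEdge ν = ∀ i j → ¬ NegEdge (ν i) (ν j)

  module _ {n} {ν ν′ : Fin n → Uv} (same : SameEqType ν ν′) where

    SameEqType-▹ : ∀ {a a′} → (∀ i → (ν i ≡ a) ⇔ (ν′ i ≡ a′)) → SameEqType (ν ▹ a) (ν′ ▹ a′)
    SameEqType-▹ _ zero    zero    = mk⇔ (λ _ → refl) (λ _ → refl)
    SameEqType-▹ h zero    (suc j) = mk⇔ (sym ∘ to (h j) ∘ sym) (sym ∘ from (h j) ∘ sym)
    SameEqType-▹ h (suc i) zero    = h i
    SameEqType-▹ _ (suc i) (suc j) = same i j

    SameEqType-▹-image : ∀ {k a a′} → ν k ≡ a → ν′ k ≡ a′ → SameEqType (ν ▹ a) (ν′ ▹ a′)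
    SameEqType-▹-image {k} refl refl = SameEqType-▹ λ i → same i k

    SameEqType-▹-fresh : ∀ {a a′} → (∀ i → ν i ≢ a) → (∀ i → ν′ i ≢ a′) → SameEqType (ν ▹ a) (ν′ ▹ a′)
    SameEqType-▹-fresh a∉ν a′∉ν′ = SameEqType-▹ λ i → mk⇔ (⊥-elim ∘ a∉ν i) (⊥-elim ∘ a′∉ν′ i)

  module _ {n} {ν : Fin n → Uv} (avoids : AvoidsNegEdge ν) where

    AvoidsNegEdge-▹-image : ∀ {k a} → ν k ≡ a → AvoidsNegEdge (ν ▹ a)
    AvoidsNegEdge-▹-image _    zero    zero    = NegEdge-irrefl
    AvoidsNegEdge-▹-image refl zero    (suc j) = avoids _ j
    AvoidsNegEdge-▹-image refl (suc i) zero    = avoids i _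
    AvoidsNegEdge-▹-image _    (suc i) (suc j) = avoids i j

    AvoidsNegEdge-▹-fresh : ∀ {a} → a ≢ e₀ → a ≢ e₁ → AvoidsNegEdge (ν ▹ a)
    AvoidsNegEdge-▹-fresh _    _    zero    zero    = NegEdge-irrefl
    AvoidsNegEdge-▹-fresh a≢e₀ _    zero    (suc j) = a≢e₀ ∘ proj₁
    AvoidsNegEdge-▹-fresh _    a≢e₁ (suc i) zero    = a≢e₁ ∘ proj₂
    AvoidsNegEdge-▹-fresh _    _    (suc i) (suc j) = avoids i j

  fresh : ∀ {n} (ν : Fin n → Uv) → suc n ≤ M → ∃ λ a → a ≢ e₀ × a ≢ e₁ × (∀ i → ν i ≢ a)
  fresh ν n<M with missingValue (s≤s (s≤s n<M)) (ν ▹ e₁ ▹ e₀)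
  ... | a , missed = a , missed zero ∘ sym , missed (suc zero) ∘ sym , λ i → missed (suc (suc i))

  matchingWitness : ∀ {n} {ν ν′ : Fin n → Uv} → SameEqType ν ν′ → AvoidsNegEdge ν → suc n ≤ M →
                    ∀ a′ → ∃ λ a → SameEqType (ν ▹ a) (ν′ ▹ a′) × AvoidsNegEdge (ν ▹ a)
  matchingWitness {ν = ν} {ν′} same avoids n<M a′ with any? (λ i → ν′ i ≟ a′)
  ... | yes (i , ν′i≡a′) = ν i , SameEqType-▹-image same refl ν′i≡a′ , AvoidsNegEdge-▹-image avoids refl
  ... | no  a′∉ν′ =
    let a , a≢e₀ , a≢e₁ , a∉ν = fresh ν n<M
    in a , SameEqType-▹-fresh same a∉ν (λ i ν′i≡a′ → a′∉ν′ (i , ν′i≡a′)) , AvoidsNegEdge-▹-fresh avoids a≢e₀ a≢e₁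

  dist>-transfer : ∀ s {m} (x y : Fin m) {μ μ′} → (μ′ x ≡ μ′ y → μ x ≡ μ y) →
                   πA ⊨ dist> s x y [ μ ] → πB ⊨ dist> s x y [ μ′ ]
  dist>-transfer zero    x y reflect far = ⊨neq⁺ (⊨neq⁻ far ∘ reflect)
  dist>-transfer (suc s) x y _       far = ⊥-elim (¬⊨dist>-suc πA-¬E-asym s x y far)

  local-transfer : ∀ {r n} {c : Fin n} {φ} (p : IsLocal r c φ) {ν ν′ : Fin n → Uv} →
                   SameEqType ν ν′ → AvoidsNegEdge ν → rank p + n ≤ M → πA ⊨ φ [ ν ] → πB ⊨ φ [ ν′ ]
  local-transfer (l-eq x y)  same _ _ e = ⊨eq⁺ (to (same x y) (⊨eq⁻ e))
  local-transfer (l-neq x y) same _ _ e = ⊨neq⁺ (⊨neq⁻ e ∘ from (same x y))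
  local-transfer (l-E x y) {ν′ = ν′} same _ _ (⊨-by e) =
    ⊨-by (subst (λ w → πB (posE (ν′ x) w) ≡ 𝟙) (to (same x y) (πA-E⇒≡ e)) (πB-loop (ν′ x)))
  local-transfer (l-nE x y)  _ avoids _ (⊨-by e) = ⊥-elim (avoids x y (πA-¬E⇒NegEdge e))
  local-transfer (l-U x)     _ _ _ _ = ⊨-by refl
  local-transfer (l-nU x)    _ _ _ (⊨-by ())
  local-transfer (l-∨ p q) same avoids b e =
    ⊨∨⁺ (Sum.map (local-transfer p same avoids (⊔+≤⇒ˡ (rank p) (rank q) b))
                 (local-transfer q same avoids (⊔+≤⇒ʳ (rank p) (rank q) b)) (⊨∨⁻ e))
  local-transfer (l-∧ p q) same avoids b e =
    let eφ , eψ = ⊨∧⁻ e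
    in ⊨∧⁺ (local-transfer p same avoids (⊔+≤⇒ˡ (rank p) (rank q) b) eφ)
           (local-transfer q same avoids (⊔+≤⇒ʳ (rank p) (rank q) b) eψ)
  local-transfer {r} {c = c} (l-∃ p) {ν′ = ν′} same avoids b e =
    let a , e′ = ⊨∃⁻ e
        near , eθ = ⊨∧⁻ e′
        -- at value 𝟙 the only element within distance r of the centre is the centre itself
        νc≡a = dist≤-sound πA-E⇒≡ r (suc c) zero near
    in ⊨∃⁺ (ν′ c) (⊨∧⁺ (dist≤-complete πB-loop r (suc c) zero refl)
                       (local-transfer p (SameEqType-▹-image same νc≡a refl)
                                         (AvoidsNegEdge-▹-image avoids νc≡a)
                                         (suc+≤⇒+suc (rank p) b) eθ))
  local-transfer {r} {c = c} (l-∀ p) same avoids b e = ⊨∀⁺ λ a′ →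
    let a , same′ , avoids′ = matchingWitness same avoids (suc+≤⇒suc≤ (rank p) b) a′
    in ⊨∨⁺ (Sum.map (dist>-transfer r (suc c) zero (from (same′ (suc c) zero)))
                    (local-transfer p same′ avoids′ (suc+≤⇒+suc (rank p) b))
                    (⊨∨⁻ (⊨∀⁻ e a)))

  Transfers : ∀ {m} → Fm m → Set
  Transfers φ = ∀ {ν} → πA ⊨ φ [ ν ] → πB ⊨ φ [ ν ]

  ∨-transfers : ∀ {m} {φ ψ : Fm m} → Transfers φ → Transfers ψ → Transfers (φ ∨' ψ)
  ∨-transfers tφ tψ e = ⊨∨⁺ (Sum.map tφ tψ (⊨∨⁻ e))

  ∧-transfers : ∀ {m} {φ ψ : Fm m} → Transfers φ → Transfers ψ → Transfers (φ ∧' ψ)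
  ∧-transfers tφ tψ e = let eφ , eψ = ⊨∧⁻ e in ⊨∧⁺ (tφ eφ) (tψ eψ)

  ∃-transfers : ∀ {m} {φ : Fm (suc m)} → Transfers φ → Transfers (∃' φ)
  ∃-transfers tφ e = let a , eφ = ⊨∃⁻ e in ⊨∃⁺ a (tφ eφ)

  ∀-transfers : ∀ {m} {φ : Fm (suc m)} → Transfers φ → Transfers (∀' φ)
  ∀-transfers tφ e = ⊨∀⁺ λ a → tφ (⊨∀⁻ e a)

  exists*-transfers : ∀ m {φ : Fm m} → Transfers φ → Transfers (exists* m φ)
  exists*-transfers zero    tφ = tφ
  exists*-transfers (suc m) tφ = exists*-transfers m (∃-transfers tφ)

  forall*-transfers : ∀ m {φ : Fm m} → Transfers φ → Transfers (forall* m φ)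
  forall*-transfers zero    tφ = tφ
  forall*-transfers (suc m) tφ = forall*-transfers m (∀-transfers tφ)

  ⋀-transfers : ∀ {m} {φ : Fm m} {ψs} → Transfers φ → All Transfers ψs → Transfers (⋀ φ ψs)
  ⋀-transfers tφ []         = tφ
  ⋀-transfers tφ (tψ ∷ tψs) = ∧-transfers tφ (⋀-transfers tψ tψs)

  ⋁-transfers : ∀ {m} {φ : Fm m} {ψs} → Transfers φ → All Transfers ψs → Transfers (⋁ φ ψs)
  ⋁-transfers tφ []         = tφ
  ⋁-transfers tφ (tψ ∷ tψs) = ∨-transfers tφ (⋁-transfers tψ tψs)

  dist≤-transfers : ∀ s {m} (x y : Fin m) → Transfers (dist≤ s x y)
  dist≤-transfers s x y e = dist≤-complete πB-loop s x y (dist≤-sound πA-E⇒≡ s x y e)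

  dist>-transfers : ∀ s {m} (x y : Fin m) → Transfers (dist> s x y)
  dist>-transfers s x y = dist>-transfer s x y (λ same → same)

  map-transfers : ∀ {A : Set} {m} {f : A → Fm m} → (∀ a → Transfers (f a)) → ∀ as → All Transfers (map f as)
  map-transfers t as = map⁺ (universal t as)

  at-transfers : ∀ {r} {φ : Fm 1} (p : IsLocal r zero φ) → rank p + 1 ≤ M → ∀ {m} (i : Fin m) → Transfers (at φ i)
  at-transfers {φ = φ} p b i {ν} (⊨-by e) =
    ⊨-by (trans (⟦rename⟧ K₃ πB (λ _ → i) φ (λ _ → refl))
                (value≡𝟙 (local-transfer p (λ _ _ → ⇔.refl) (λ _ _ → NegEdge-irrefl) b
                                          (⊨-by (trans (sym (⟦rename⟧ K₃ πA (λ _ → i) φ (λ _ → refl))) e)))))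

  basicLocal∃-transfers : ∀ {r} k {φ : Fm 1} (p : IsLocal r zero φ) → rank p + 1 ≤ M → Transfers (basicLocal∃ r k φ)
  basicLocal∃-transfers {r} k p b =
    exists*-transfers (suc k)
      (⋀-transfers (at-transfers p b zero)
                   (++⁺ (map-transfers (λ (i , j) → dist>-transfers (2 * r) i j) (pairs (suc k)))
                        (map-transfers (at-transfers p b ∘ suc) (allFin k))))

  basicLocal∀-transfers : ∀ {r} k {φ : Fm 1} (p : IsLocal r zero φ) → rank p + 1 ≤ M → Transfers (basicLocal∀ r k φ)
  basicLocal∀-transfers {r} k p b =
    forall*-transfers (suc k)
      (⋁-transfers (at-transfers p b zero)
                   (++⁺ (map-transfers (λ (i , j) → dist≤-transfers (2 * r) i j) (pairs (suc k)))
                        (map-transfers (at-transfers p b ∘ suc) (allFin k))))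

  posBoolComb-transfers : ∀ {ψ} (d : IsPosBoolCombBL ψ) → pbRank d + 1 ≤ M → Transfers ψ
  posBoolComb-transfers (pb-base (bl-∃ _ k _ p)) b = basicLocal∃-transfers k p b
  posBoolComb-transfers (pb-base (bl-∀ _ k _ p)) b = basicLocal∀-transfers k p b
  posBoolComb-transfers (pb-∨ d e) b =
    ∨-transfers (posBoolComb-transfers d (⊔+≤⇒ˡ (pbRank d) (pbRank e) b))
                (posBoolComb-transfers e (⊔+≤⇒ʳ (pbRank d) (pbRank e) b))
  posBoolComb-transfers (pb-∧ d e) b =
    ∧-transfers (posBoolComb-transfers d (⊔+≤⇒ˡ (pbRank d) (pbRank e) b))
                (posBoolComb-transfers e (⊔+≤⇒ʳ (pbRank d) (pbRank e) b))

propositionA1 : ¬ (Σ (Fm 0) (λ ψ → IsPosBoolCombBL ψ × MinmaxEquivalent ψ β))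
propositionA1 (ψ , d , ψ≈β) = 𝟘≢𝟙 (begin
    𝟘                            ≡⟨ sym πB-β≡𝟘 ⟩
    ⟦_⟧ K₃ β πB noVars           ≡⟨ sym (ψ≈β K₃ (suc M) πB πB-modelDefining πB-tracksPositive) ⟩
    ⟦_⟧ K₃ ψ πB noVars           ≡⟨ value≡𝟙 (posBoolComb-transfers d ≤-refl πA⊨ψ) ⟩
    𝟙                            ∎)
  where
  M = pbRank d + 1
  open Models M
  open ≡-Reasoning
  πA⊨ψ : πA ⊨ ψ [ noVars ]
  πA⊨ψ = ⊨-by (trans (ψ≈β K₃ (suc M) πA πA-modelDefining πA-tracksPositive) (value≡𝟙 πA⊨β))
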